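{- Let $G$ be a finite simple König-Egerváry graph, i.e. $\beta(G)=\nu(G)$. Then $m(G)\le 2^{\nu(G)}$, and equality holds if and only if $G$ is bipartite and $\nu(G)=\nu_0(G)$ (i.e. $G$ is a bipartite Cameron-Walker graph).
   Context: For a finite simple graph $G$, $m(G)$ denotes the number of maximal independent sets of $G$ (a graph with no edges, including the graph with no vertices, has $m(G)=1$). $\beta(G)$ is the minimum size of a vertex cover of $G$ (a set of vertices meeting every edge). $\nu(G)$ is the maximum size of a matching (set of pairwise disjoint edges). An induced matching is a matching $M$ such that no two edges of $M$ are joined by an edge of $G$; $\nu_0(G)$ is its maximum size. $G$ is König-Egerváry if $\beta(G)=\nu(G)$, and Cameron-Walker if $\nu(G)=\nu_0(G)$. -}

module Defs where

open import Data.Nat using (ℕ; zero; suc; _≤_)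
open import Data.Bool using (Bool; true; false)
open import Data.Bool.Properties using () renaming (_≟_ to _≟ᵇ_)
open import Data.Fin using (Fin; _≟_)
open import Data.Fin.Subset using (Subset; _∈_; _∉_; ⁅_⁆; _∪_; ∣_∣; inside; outside)
open import Data.Fin.Subset.Properties using (_∈?_)
open import Data.Fin.Properties using (all?)
open import Data.Vec using (_∷_; [])
open import Data.List using (List; _∷_; []; map; _++_; length; filter)
open import Data.Product using (Σ; ∃; _×_; _,_)
open import Data.Sum using (_⊎_)
open import Relation.Binary.PropositionalEquality using (_≡_; _≢_)
open import Relation.Nullary using (¬_; Dec)
open import Relation.Nullary.Decidable using (_→-dec_; _×-dec_; ¬?)

record Graph (n : ℕ) : Set where
  field
    Adj   : Fin n → Fin n → Bool
    sym   : ∀ u v → Adj u v ≡ Adj v u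
    irrefl : ∀ u → Adj u u ≡ false
open Graph public

module _ {n : ℕ} (G : Graph n) where

  IsIndependent : Subset n → Set
  IsIndependent S = ∀ u v → u ∈ S → v ∈ S → Adj G u v ≡ false

  IsMaximalIndependent : Subset n → Set
  IsMaximalIndependent S =
    IsIndependent S × (∀ w → w ∉ S → ¬ IsIndependent (⁅ w ⁆ ∪ S))

  isIndependent? : (S : Subset n) → Dec (IsIndependent S)
  isIndependent? S =
    all? λ u → all? λ v → (u ∈? S) →-dec ((v ∈? S) →-dec (Adj G u v ≟ᵇ false))

  isMaximalIndependent? : (S : Subset n) → Dec (IsMaximalIndependent S)
  isMaximalIndependent? S =
    isIndependent? S ×-dec
      (all? λ w → ¬? (w ∈? S) →-dec ¬? (isIndependent? (⁅ w ⁆ ∪ S)))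

allSubsets : (n : ℕ) → List (Subset n)
allSubsets zero = [] ∷ []
allSubsets (suc n) = map (outside ∷_) (allSubsets n) ++ map (inside ∷_) (allSubsets n)

m : {n : ℕ} → Graph n → ℕ
m {n} G = length (filter (isMaximalIndependent? G) (allSubsets n))

module _ {n : ℕ} (G : Graph n) where

  IsVertexCover : Subset n → Set
  IsVertexCover S = ∀ u v → Adj G u v ≡ true → u ∈ S ⊎ v ∈ S

  IsCoverNumber : ℕ → Set
  IsCoverNumber k =
    (Σ (Subset n) λ S → IsVertexCover S × ∣ S ∣ ≡ k) ×
    (∀ S → IsVertexCover S → k ≤ ∣ S ∣)

  Edge : Set
  Edge = Σ (Fin n × Fin n) λ { (u , v) → Adj G u v ≡ true }

  Disjoint : Edge → Edge → Set
  Disjoint ((a , b) , _) ((c , d) , _) = a ≢ c × a ≢ d × b ≢ c × b ≢ d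

  NotJoined : Edge → Edge → Set
  NotJoined ((a , b) , _) ((c , d) , _) =
    Adj G a c ≡ false × Adj G a d ≡ false × Adj G b c ≡ false × Adj G b d ≡ false

  IsMatching : {k : ℕ} → (Fin k → Edge) → Set
  IsMatching {k} M = ∀ (i j : Fin k) → i ≢ j → Disjoint (M i) (M j)

  IsInducedMatching : {k : ℕ} → (Fin k → Edge) → Set
  IsInducedMatching {k} M =
    IsMatching M × (∀ (i j : Fin k) → i ≢ j → NotJoined (M i) (M j))

  HasMatchingOfSize : ℕ → Set
  HasMatchingOfSize k = Σ (Fin k → Edge) IsMatching

  HasInducedMatchingOfSize : ℕ → Set
  HasInducedMatchingOfSize k = Σ (Fin k → Edge) IsInducedMatching

  IsMatchingNumber : ℕ → Set
  IsMatchingNumber k = HasMatchingOfSize k × (∀ j → HasMatchingOfSize j → j ≤ k)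

  IsInducedMatchingNumber : ℕ → Set
  IsInducedMatchingNumber k =
    HasInducedMatchingOfSize k × (∀ j → HasInducedMatchingOfSize j → j ≤ k)

  IsBipartite : Set
  IsBipartite = Σ (Fin n → Bool) λ c → ∀ u v → Adj G u v ≡ true → c u ≢ c v

module Submission where

-- Let C be a minimum vertex cover, so |C| = ν. A maximal independent set S is determined by its
-- trace C ∩ S: a vertex outside C has all its neighbours in C, and by maximality it lies in S
-- exactly when none of them does. Hence m(G) ≤ 2^|C|, with equality only if every trace is
-- realised. The trace C then makes C independent, so (C, V ∖ C) is a bipartition, and the trace
-- C ∖ {c} gives every c ∈ C a private neighbour outside C; pairing the cover endpoints of a maximum
-- matching with their private neighbours yields an induced matching of size ν. Conversely, an
-- induced matching of size ν₀ = ν yields 2^ν maximal independent sets, one for each choice of an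
-- endpoint in every edge.

open import Defs renaming (sym to Adj-sym)
open import Data.Nat using (ℕ; zero; suc; _+_; _≤_; _<_; _^_; z≤n)
open import Data.Nat.Properties
  using (module ≤-Reasoning; ≤-refl; ≤-antisym; <-irrefl; +-suc; +-identityʳ; +-mono-≤; +-monoˡ-≤)
open import Data.Bool using (Bool; true; false)
open import Data.Bool.Properties using (¬-not; not-¬) renaming (_≟_ to _≟ᵇ_)
open import Data.Fin using (Fin; zero; suc)
import Data.Fin as Fin
open import Data.Fin.Properties using (any?; all?)
open import Data.Fin.Subset
  using (Subset; inside; outside; _∈_; _∉_; _⊆_; _∩_; _∪_; ∁; ⁅_⁆; ∣_∣; ⊤) renaming (⊥ to ⊥ˢ)
open import Data.Fin.Subset.Properties
  using (_∈?_; ⊆-antisym; x∈p∩q⁺; x∈p∩q⁻; x∈p∪q⁺; x∈p∪q⁻; x∈⁅x⁆; x∈⁅y⁆⇒x≡y; x≢y⇒x∉⁅y⁆; ∉⊥; ∈⊤;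
         x∈∁p⇒x∉p; x∉p⇒x∈∁p)
open import Data.Vec using (_∷_; []; lookup)
open import Data.Vec.Properties using (∷-injectiveˡ; ∷-injectiveʳ; ≡-dec; []=⇒lookup; lookup⇒[]=)
open import Data.List using (List; []; _∷_; _++_; map; length; filter; allFin)
open import Data.List.Membership.Propositional using () renaming (_∈_ to _∈ˡ_)
open import Data.List.Membership.Propositional.Properties using (∈-allFin)
open import Data.List.Properties using (length-++; filter-++; filter-some)
open import Data.List.Relation.Unary.Any using (Any; here; there)
open import Data.List.Relation.Unary.Any.Properties using (map⁺; ++⁺ˡ; ++⁺ʳ)
open import Data.Product using (∃; ∃-syntax; _×_; _,_; proj₁; proj₂)
open import Data.Sum using (_⊎_; inj₁; inj₂; [_,_]′)
open import Data.Empty using (⊥-elim)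
open import Function using (_∘_; case_of_)
open import Function.Bundles using (_⇔_; mk⇔)
open import Relation.Binary.PropositionalEquality
  using (_≡_; _≢_; refl; sym; trans; cong; cong₂; subst; module ≡-Reasoning)
open import Relation.Nullary using (¬_; Dec; yes; no; does; contradiction)
open import Relation.Nullary.Decidable using (_⊎-dec_; _×-dec_; _→-dec_; ¬?; decidable-stable)
open import Relation.Unary using (Pred; Decidable)
open import Relation.Binary using (DecidableEquality)
open import Level using (Level)

private
  variable
    a ℓ ℓ′ : Level
    A : Set a
    n k : ℕ

count : {P : Pred A ℓ} → Decidable P → List A → ℕ
count P? = length ∘ filter P?

module _ {P : Pred A ℓ} (P? : Decidable P) where

  count-++ : ∀ xs ys → count P? (xs ++ ys) ≡ count P? xs + count P? ys
  count-++ xs ys = trans (cong length (filter-++ P? xs ys)) (length-++ (filter P? xs))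

  count-map : ∀ {B : Set} (f : B → A) xs → count P? (map f xs) ≡ count (P? ∘ f) xs
  count-map f [] = refl
  count-map f (x ∷ xs) with does (P? (f x))
  ... | true  = cong suc (count-map f xs)
  ... | false = count-map f xs

  module _ {Q : Pred A ℓ′} (Q? : Decidable Q) where

    count-⊎ : (∀ {x} → P x → ¬ Q x) → ∀ xs →
      count (λ x → P? x ⊎-dec Q? x) xs ≡ count P? xs + count Q? xs
    count-⊎ disj [] = refl
    count-⊎ disj (x ∷ xs) with P? x | Q? x
    ... | yes px | yes qx = contradiction qx (disj px)
    ... | yes _  | no _   = cong suc (count-⊎ disj xs)
    ... | no _   | yes _  = trans (cong suc (count-⊎ disj xs)) (sym (+-suc _ _))
    ... | no _   | no _   = count-⊎ disj xs

    count-×-split : ∀ xs →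
      count (λ x → P? x ×-dec Q? x) xs + count (λ x → P? x ×-dec ¬? (Q? x)) xs ≡ count P? xs
    count-×-split [] = refl
    count-×-split (x ∷ xs) with P? x | Q? x
    ... | yes _ | yes _ = cong suc (count-×-split xs)
    ... | yes _ | no _  = trans (+-suc _ _) (cong suc (count-×-split xs))
    ... | no _  | _     = count-×-split xs

count-allSubsets-suc : {P : Pred (Subset (suc n)) ℓ} (P? : Decidable P) →
  count P? (allSubsets (suc n)) ≡
  count (P? ∘ (outside ∷_)) (allSubsets n) + count (P? ∘ (inside ∷_)) (allSubsets n)
count-allSubsets-suc {n = n} P? = begin
  count P? (map (outside ∷_) (allSubsets n) ++ map (inside ∷_) (allSubsets n))
    ≡⟨ count-++ P? (map (outside ∷_) (allSubsets n)) _ ⟩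
  count P? (map (outside ∷_) (allSubsets n)) + count P? (map (inside ∷_) (allSubsets n))
    ≡⟨ cong₂ _+_ (count-map P? _ (allSubsets n)) (count-map P? _ (allSubsets n)) ⟩
  count (P? ∘ (outside ∷_)) (allSubsets n) + count (P? ∘ (inside ∷_)) (allSubsets n) ∎
  where open ≡-Reasoning

any-allSubsets : (P : Pred (Subset n) ℓ) {S : Subset n} → P S → Any P (allSubsets n)
any-allSubsets P {[]}          pS = here pS
any-allSubsets P {outside ∷ S} pS = ++⁺ˡ (map⁺ (any-allSubsets (P ∘ (outside ∷_)) pS))
any-allSubsets P {inside ∷ S}  pS = ++⁺ʳ _ (map⁺ (any-allSubsets (P ∘ (inside ∷_)) pS))

count-allSubsets-pos : {P : Pred (Subset n) ℓ} (P? : Decidable P) {S : Subset n} →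
  P S → 0 < count P? (allSubsets n)
count-allSubsets-pos {P = P} P? pS = filter-some P? (any-allSubsets P pS)

∈-trace : ∀ {C S T : Subset n} {v} → C ∩ S ≡ C ∩ T → v ∈ C → v ∈ T → v ∈ S
∈-trace {C = C} {S} tr v∈C v∈T = proj₂ (x∈p∩q⁻ C S (subst (_ ∈_) (sym tr) (x∈p∩q⁺ (v∈C , v∈T))))

image : (Fin k → Fin n) → Subset n
image {k = zero}  f = ⊥ˢ
image {k = suc k} f = ⁅ f zero ⁆ ∪ image (f ∘ suc)

∈-image⁺ : (f : Fin k → Fin n) (i : Fin k) → f i ∈ image f
∈-image⁺ f zero    = x∈p∪q⁺ (inj₁ (x∈⁅x⁆ (f zero)))
∈-image⁺ f (suc i) = x∈p∪q⁺ (inj₂ (∈-image⁺ (f ∘ suc) i))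

∈-image⁻ : (f : Fin k → Fin n) {v : Fin n} → v ∈ image f → ∃[ i ] v ≡ f i
∈-image⁻ {k = zero}  f v∈ = ⊥-elim (∉⊥ v∈)
∈-image⁻ {k = suc k} f v∈ with x∈p∪q⁻ ⁅ f zero ⁆ (image (f ∘ suc)) v∈
... | inj₁ v∈⁅f0⁆ = zero , x∈⁅y⁆⇒x≡y (f zero) v∈⁅f0⁆
... | inj₂ v∈rest = let i , v≡ = ∈-image⁻ (f ∘ suc) v∈rest in suc i , v≡

DeterminedByTrace : Subset n → Pred (Subset n) ℓ → Set ℓ
DeterminedByTrace C P = ∀ {S T} → P S → P T → C ∩ S ≡ C ∩ T → S ≡ T

Shatters : Pred (Subset n) ℓ → (Fin k → Fin n) → Set ℓ
Shatters {k = k} P vs = ∀ (b : Fin k → Bool) → ∃[ S ] P S × (∀ i → lookup S (vs i) ≡ b i)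

DeterminedByTrace-tail : {P : Pred (Subset (suc n)) ℓ} {s : Bool} {C : Subset n} →
  DeterminedByTrace (s ∷ C) P → ∀ b → DeterminedByTrace C (P ∘ (b ∷_))
DeterminedByTrace-tail det b pS pT tr = ∷-injectiveʳ (det pS pT (cong (_ ∷_) tr))

DeterminedByTrace-merge : {P : Pred (Subset (suc n)) ℓ} {C : Subset n} → DeterminedByTrace (outside ∷ C) P →
  DeterminedByTrace C (λ S → P (outside ∷ S) ⊎ P (inside ∷ S))
DeterminedByTrace-merge {P = P} det pS pT tr =
  ∷-injectiveʳ (det (proj₂ (witness pS)) (proj₂ (witness pT)) (cong (outside ∷_) tr))
  where
  witness : ∀ {S} → P (outside ∷ S) ⊎ P (inside ∷ S) → ∃[ b ] P (b ∷ S)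
  witness (inj₁ pS) = outside , pS
  witness (inj₂ pS) = inside , pS

count≤2^∣C∣ : {P : Pred (Subset n) ℓ} (P? : Decidable P) (C : Subset n) → DeterminedByTrace C P →
  count P? (allSubsets n) ≤ 2 ^ ∣ C ∣
count≤2^∣C∣ {n = zero} P? [] det with does (P? [])
... | true  = ≤-refl
... | false = z≤n
count≤2^∣C∣ {n = suc n} P? (inside ∷ C) det = begin
  count P? (allSubsets (suc n))
    ≡⟨ count-allSubsets-suc P? ⟩
  count (P? ∘ (outside ∷_)) (allSubsets n) + count (P? ∘ (inside ∷_)) (allSubsets n)
    ≤⟨ +-mono-≤ (count≤2^∣C∣ _ C (DeterminedByTrace-tail det outside))
                (count≤2^∣C∣ _ C (DeterminedByTrace-tail det inside)) ⟩
  2 ^ ∣ C ∣ + 2 ^ ∣ C ∣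
    ≡⟨ cong (2 ^ ∣ C ∣ +_) (sym (+-identityʳ _)) ⟩
  2 ^ suc ∣ C ∣ ∎
  where open ≤-Reasoning
count≤2^∣C∣ {n = suc n} {P = P} P? (outside ∷ C) det = begin
  count P? (allSubsets (suc n))
    ≡⟨ count-allSubsets-suc P? ⟩
  count (P? ∘ (outside ∷_)) (allSubsets n) + count (P? ∘ (inside ∷_)) (allSubsets n)
    ≡⟨ count-⊎ (P? ∘ (outside ∷_)) (P? ∘ (inside ∷_)) distinct (allSubsets n) ⟨
  count (λ S → P? (outside ∷ S) ⊎-dec P? (inside ∷ S)) (allSubsets n)
    ≤⟨ count≤2^∣C∣ _ C (DeterminedByTrace-merge det) ⟩
  2 ^ ∣ C ∣ ∎
  where
  open ≤-Reasoning
  distinct : ∀ {S} → P (outside ∷ S) → ¬ P (inside ∷ S)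
  distinct pS pS′ with () ← ∷-injectiveˡ (det pS pS′ refl)

-- A trace missed by P leaves room for one more set: adjoin T itself to P.
count<2^∣C∣ : {P : Pred (Subset n) ℓ} (P? : Decidable P) (C : Subset n) → DeterminedByTrace C P →
  (T : Subset n) → (∀ {S} → P S → C ∩ S ≢ C ∩ T) → count P? (allSubsets n) < 2 ^ ∣ C ∣
count<2^∣C∣ {n = n} {P = P} P? C det T missed = begin-strict
  count P? (allSubsets n)
    <⟨ +-monoˡ-≤ (count P? (allSubsets n)) (count-allSubsets-pos (_≟ˢ T) refl) ⟩
  count (_≟ˢ T) (allSubsets n) + count P? (allSubsets n)
    ≡⟨ count-⊎ (_≟ˢ T) P? (λ { refl pT → missed pT refl }) (allSubsets n) ⟨
  count (λ S → (S ≟ˢ T) ⊎-dec P? S) (allSubsets n)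
    ≤⟨ count≤2^∣C∣ _ C det′ ⟩
  2 ^ ∣ C ∣ ∎
  where
  open ≤-Reasoning
  _≟ˢ_ : DecidableEquality (Subset n)
  _≟ˢ_ = ≡-dec _≟ᵇ_
  det′ : DeterminedByTrace C (λ S → S ≡ T ⊎ P S)
  det′ (inj₁ refl) (inj₁ refl) _  = refl
  det′ (inj₁ refl) (inj₂ pS)   tr = ⊥-elim (missed pS (sym tr))
  det′ (inj₂ pS)   (inj₁ refl) tr = ⊥-elim (missed pS tr)
  det′ (inj₂ pS)   (inj₂ pT)   tr = det pS pT tr

2^k≤count : {P : Pred (Subset n) ℓ} (P? : Decidable P) (vs : Fin k → Fin n) → Shatters P vs →
  2 ^ k ≤ count P? (allSubsets n)
2^k≤count {k = zero} P? _ shatters = count-allSubsets-pos P? (proj₁ (proj₂ (shatters λ ())))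
2^k≤count {n = n} {k = suc k} {P = P} P? vs shatters = begin
  2 ^ k + (2 ^ k + 0)
    ≡⟨ cong (2 ^ k +_) (+-identityʳ _) ⟩
  2 ^ k + 2 ^ k
    ≤⟨ +-mono-≤ (2^k≤count _ (vs ∘ suc) shattersIn) (2^k≤count _ (vs ∘ suc) shattersOut) ⟩
  count (λ S → P? S ×-dec first? S) (allSubsets n) +
  count (λ S → P? S ×-dec ¬? (first? S)) (allSubsets n)
    ≡⟨ count-×-split P? first? (allSubsets n) ⟩
  count P? (allSubsets n) ∎
  where
  open ≤-Reasoning
  first? : Decidable (λ S → lookup S (vs zero) ≡ true)
  first? S = lookup S (vs zero) ≟ᵇ true
  shattersIn : Shatters (λ S → P S × lookup S (vs zero) ≡ true) (vs ∘ suc)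
  shattersIn b with shatters (λ { zero → true ; (suc i) → b i })
  ... | S , pS , agrees = S , (pS , agrees zero) , agrees ∘ suc
  shattersOut : Shatters (λ S → P S × lookup S (vs zero) ≢ true) (vs ∘ suc)
  shattersOut b with shatters (λ { zero → false ; (suc i) → b i })
  ... | S , pS , agrees = S , (pS , not-¬ (agrees zero)) , agrees ∘ suc

module _ {n : ℕ} (G : Graph n) where

  ∪-independent : ∀ {S} v → IsIndependent G S → (∀ w → w ∈ S → Adj G v w ≡ false) →
    IsIndependent G (⁅ v ⁆ ∪ S)
  ∪-independent {S} v indS v≁S u w u∈ w∈ with x∈p∪q⁻ ⁅ v ⁆ S u∈ | x∈p∪q⁻ ⁅ v ⁆ S w∈
  ... | inj₁ u∈⁅v⁆ | inj₁ w∈⁅v⁆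
    rewrite x∈⁅y⁆⇒x≡y v u∈⁅v⁆ | x∈⁅y⁆⇒x≡y v w∈⁅v⁆ = irrefl G v
  ... | inj₁ u∈⁅v⁆ | inj₂ w∈S rewrite x∈⁅y⁆⇒x≡y v u∈⁅v⁆ = v≁S w w∈S
  ... | inj₂ u∈S   | inj₁ w∈⁅v⁆ rewrite x∈⁅y⁆⇒x≡y v w∈⁅v⁆ = trans (Adj-sym G u v) (v≁S u u∈S)
  ... | inj₂ u∈S   | inj₂ w∈S = indS u w u∈S w∈S

  greedy : List (Fin n) → Subset n → Subset n
  greedy []       S = S
  greedy (w ∷ ws) S with isIndependent? G (⁅ w ⁆ ∪ S)
  ... | yes _ = greedy ws (⁅ w ⁆ ∪ S)
  ... | no  _ = greedy ws S

  greedy-independent : ∀ ws {S} → IsIndependent G S → IsIndependent G (greedy ws S)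
  greedy-independent []       indS = indS
  greedy-independent (w ∷ ws) {S} indS with isIndependent? G (⁅ w ⁆ ∪ S)
  ... | yes ind = greedy-independent ws ind
  ... | no  _   = greedy-independent ws indS

  ⊆-greedy : ∀ ws {S} → S ⊆ greedy ws S
  ⊆-greedy []       v∈S = v∈S
  ⊆-greedy (w ∷ ws) {S} v∈S with isIndependent? G (⁅ w ⁆ ∪ S)
  ... | yes _ = ⊆-greedy ws (x∈p∪q⁺ (inj₂ v∈S))
  ... | no  _ = ⊆-greedy ws v∈S

  greedy-maximal : ∀ ws {S w} → w ∈ˡ ws → w ∉ greedy ws S →
    ¬ IsIndependent G (⁅ w ⁆ ∪ greedy ws S)
  greedy-maximal (w ∷ ws) {S} (here refl) w∉ ind with isIndependent? G (⁅ w ⁆ ∪ S)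
  ... | yes _ = w∉ (⊆-greedy ws (x∈p∪q⁺ (inj₁ (x∈⁅x⁆ w))))
  ... | no  ¬ind = ¬ind λ u v u∈ v∈ → ind u v (grow u∈) (grow v∈)
    where
    grow : ⁅ w ⁆ ∪ S ⊆ ⁅ w ⁆ ∪ greedy ws S
    grow u∈ with x∈p∪q⁻ ⁅ w ⁆ S u∈
    ... | inj₁ u∈⁅w⁆ = x∈p∪q⁺ (inj₁ u∈⁅w⁆)
    ... | inj₂ u∈S   = x∈p∪q⁺ (inj₂ (⊆-greedy ws u∈S))
  greedy-maximal (x ∷ ws) {S} (there w∈ws) w∉ ind with isIndependent? G (⁅ x ⁆ ∪ S)
  ... | yes _ = greedy-maximal ws w∈ws w∉ ind
  ... | no  _ = greedy-maximal ws w∈ws w∉ ind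

  extend-to-maximal : ∀ {T} → IsIndependent G T → ∃[ S ] IsMaximalIndependent G S × T ⊆ S
  extend-to-maximal {T} indT =
    greedy (allFin n) T ,
    (greedy-independent (allFin n) indT , λ w → greedy-maximal (allFin n) (∈-allFin w)) ,
    ⊆-greedy (allFin n)

  endpoint : Bool → Edge G → Fin n
  endpoint true  ((x , _) , _) = x
  endpoint false ((_ , y) , _) = y

  notJoined-endpoints : ∀ {e e′} → NotJoined G e e′ →
    ∀ s t → Adj G (endpoint s e) (endpoint t e′) ≡ false
  notJoined-endpoints (xx′ , _ , _ , _) true  true  = xx′
  notJoined-endpoints (_ , xy′ , _ , _) true  false = xy′
  notJoined-endpoints (_ , _ , yx′ , _) false true  = yx′
  notJoined-endpoints (_ , _ , _ , yy′) false false = yy′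

  disjoint-endpoints : ∀ {e e′} → Disjoint G e e′ → ∀ s t → endpoint s e ≢ endpoint t e′
  disjoint-endpoints (x≢x′ , _ , _ , _) true  true  = x≢x′
  disjoint-endpoints (_ , x≢y′ , _ , _) true  false = x≢y′
  disjoint-endpoints (_ , _ , y≢x′ , _) false true  = y≢x′
  disjoint-endpoints (_ , _ , _ , y≢y′) false false = y≢y′

  inducedMatching-shatters : {M : Fin k → Edge G} → IsInducedMatching G M →
    Shatters (IsMaximalIndependent G) (λ i → endpoint true (M i))
  inducedMatching-shatters {k} {M} (_ , notJoined) b = S , maxS , agrees
    where
    picked : Fin k → Fin n
    picked i = endpoint (b i) (M i)
    picked-independent : IsIndependent G (image picked)
    picked-independent u v u∈ v∈ with ∈-image⁻ picked u∈ | ∈-image⁻ picked v∈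
    ... | i , refl | j , refl with i Fin.≟ j
    ...   | yes refl = irrefl G (picked i)
    ...   | no  i≢j  = notJoined-endpoints (notJoined i j i≢j) (b i) (b j)
    extension : ∃[ S ] IsMaximalIndependent G S × image picked ⊆ S
    extension = extend-to-maximal picked-independent
    S : Subset n
    S = proj₁ extension
    maxS : IsMaximalIndependent G S
    maxS = proj₁ (proj₂ extension)
    agrees : ∀ i → lookup S (endpoint true (M i)) ≡ b i
    agrees i with b i | proj₂ (proj₂ extension) (∈-image⁺ picked i)
    ... | true  | x∈S = []=⇒lookup x∈S
    ... | false | y∈S = ¬-not λ x∈S →
      not-¬ (proj₂ (M i)) (proj₁ maxS _ _ (lookup⇒[]= _ S x∈S) y∈S)

  2^k≤m : HasInducedMatchingOfSize G k → 2 ^ k ≤ m G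
  2^k≤m (M , induced) =
    2^k≤count (isMaximalIndependent? G) _ (inducedMatching-shatters {M = M} induced)

  module _ {C : Subset n} (cover : IsVertexCover G C) where

    cover-endpoint : (e : Edge G) → ∃[ s ] endpoint s e ∈ C
    cover-endpoint ((x , y) , xy) = [ (true ,_) , (false ,_) ]′ (cover x y xy)

    maximal-⊆ : ∀ {S T} → IsMaximalIndependent G T → IsIndependent G S → C ∩ S ≡ C ∩ T → S ⊆ T
    maximal-⊆ {S} {T} (indT , maxT) indS tr {v} v∈S with v ∈? C
    ... | yes v∈C = ∈-trace (sym tr) v∈C v∈S
    ... | no  v∉C = decidable-stable (v ∈? T) λ v∉T → maxT v v∉T (∪-independent v indT v≁T)
      where
      -- every neighbour of v lies in C, hence in S together with v
      v≁T : ∀ w → w ∈ T → Adj G v w ≡ false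
      v≁T w w∈T = ¬-not λ vw →
        [ v∉C , (λ w∈C → not-¬ vw (indS v w v∈S (∈-trace tr w∈C w∈T))) ]′ (cover v w vw)

    maximal-determined : DeterminedByTrace C (IsMaximalIndependent G)
    maximal-determined maxS maxT tr =
      ⊆-antisym (maximal-⊆ maxT (proj₁ maxS) tr) (maximal-⊆ maxS (proj₁ maxT) (sym tr))

    m≤2^∣C∣ : m G ≤ 2 ^ ∣ C ∣
    m≤2^∣C∣ = count≤2^∣C∣ (isMaximalIndependent? G) C maximal-determined

    TraceComplete : Set
    TraceComplete = ∀ T → ¬ (∀ {S} → IsMaximalIndependent G S → C ∩ S ≢ C ∩ T)

    m≡2^∣C∣⇒traceComplete : m G ≡ 2 ^ ∣ C ∣ → TraceComplete
    m≡2^∣C∣⇒traceComplete m≡ T missed =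
      <-irrefl m≡ (count<2^∣C∣ (isMaximalIndependent? G) C maximal-determined T missed)

    module _ (complete : TraceComplete) where

      cover-independent : IsIndependent G C
      cover-independent u v u∈C v∈C = ¬-not λ uv → complete ⊤ λ (indS , _) tr →
        not-¬ uv (indS u v (∈-trace tr u∈C ∈⊤) (∈-trace tr v∈C ∈⊤))

      bipartite : IsBipartite G
      bipartite = lookup C , λ u v uv same → not-¬ uv
        ([ (λ u∈C → cover-independent u v u∈C (recolour same u∈C))
         , (λ v∈C → cover-independent u v (recolour (sym same) v∈C) v∈C) ]′ (cover u v uv))
        where
        recolour : ∀ {u v} → lookup C u ≡ lookup C v → u ∈ C → v ∈ C
        recolour {v = v} same u∈C = lookup⇒[]= v C (trans (sym same) ([]=⇒lookup u∈C))

      PrivateNeighbour : Fin n → Fin n → Set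
      PrivateNeighbour c w =
        w ∉ C × Adj G c w ≡ true × (∀ c′ → c′ ∈ C → c′ ≢ c → Adj G c′ w ≡ false)

      privateNeighbour? : ∀ c w → Dec (PrivateNeighbour c w)
      privateNeighbour? c w = ¬? (w ∈? C) ×-dec (Adj G c w ≟ᵇ true) ×-dec
        all? λ c′ → (c′ ∈? C) →-dec ¬? (c′ Fin.≟ c) →-dec (Adj G c′ w ≟ᵇ false)

      -- Take a maximal independent set with trace C ∖ {c}: it misses c, so by maximality c has a
      -- neighbour in it, which lies outside C and is non-adjacent to the rest of C.
      privateNeighbour : ∀ {c} → c ∈ C → ∃[ w ] PrivateNeighbour c w
      privateNeighbour {c} c∈C = decidable-stable (any? (privateNeighbour? c)) λ none →
        complete (∁ ⁅ c ⁆) λ {S} (indS , maxS) tr →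
          maxS c (c∉S tr) (∪-independent c indS (c≁S none indS tr))
        where
        c∉S : ∀ {S} → C ∩ S ≡ C ∩ ∁ ⁅ c ⁆ → c ∉ S
        c∉S tr c∈S = x∈∁p⇒x∉p (∈-trace (sym tr) c∈C c∈S) (x∈⁅x⁆ c)
        c≁S : ∀ {S} → ¬ ∃ (PrivateNeighbour c) → IsIndependent G S → C ∩ S ≡ C ∩ ∁ ⁅ c ⁆ →
          ∀ w → w ∈ S → Adj G c w ≡ false
        c≁S none indS tr w w∈S = ¬-not λ cw → case w ∈? C of λ where
          (yes w∈C) → not-¬ cw (cover-independent c w c∈C w∈C)
          (no  w∉C) → none (w , w∉C , cw , λ c′ c′∈C c′≢c →
            indS c′ w (∈-trace tr c′∈C (x∉p⇒x∈∁p (x≢y⇒x∉⁅y⁆ c′≢c))) w∈S)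

      matching⇒inducedMatching : ∀ {k} → HasMatchingOfSize G k → HasInducedMatchingOfSize G k
      matching⇒inducedMatching {k} (M , matching) =
        M′ , (λ i j i≢j → c≢c i≢j , c≢p , (λ q → c≢p (sym q)) , p≢p i≢j) ,
             (λ i j i≢j → cover-independent _ _ (c∈C i) (c∈C j) ,
                          p-private j _ (c∈C i) (c≢c i≢j) ,
                          trans (Adj-sym G (p i) (c j)) (p-private i _ (c∈C j) (c≢c (i≢j ∘ sym))) ,
                          ¬-not λ pp → [ p∉C i , p∉C j ]′ (cover (p i) (p j) pp))
        where
        side : Fin k → Bool
        side i = proj₁ (cover-endpoint (M i))
        c : Fin k → Fin n
        c i = endpoint (side i) (M i)
        c∈C : ∀ i → c i ∈ C
        c∈C i = proj₂ (cover-endpoint (M i))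
        p : Fin k → Fin n
        p i = proj₁ (privateNeighbour (c∈C i))
        p∉C : ∀ i → p i ∉ C
        p∉C i = proj₁ (proj₂ (privateNeighbour (c∈C i)))
        c~p : ∀ i → Adj G (c i) (p i) ≡ true
        c~p i = proj₁ (proj₂ (proj₂ (privateNeighbour (c∈C i))))
        p-private : ∀ i c′ → c′ ∈ C → c′ ≢ c i → Adj G c′ (p i) ≡ false
        p-private i = proj₂ (proj₂ (proj₂ (privateNeighbour (c∈C i))))
        M′ : Fin k → Edge G
        M′ i = (c i , p i) , c~p i
        c≢c : ∀ {i j} → i ≢ j → c i ≢ c j
        c≢c {i} {j} i≢j = disjoint-endpoints (matching i j i≢j) (side i) (side j)
        c≢p : ∀ {i j} → c i ≢ p j
        c≢p {i} {j} q = p∉C j (subst (_∈ C) q (c∈C i))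
        p≢p : ∀ {i j} → i ≢ j → p i ≢ p j
        p≢p {i} {j} i≢j q = not-¬ (c~p i)
          (subst (λ w → Adj G (c i) w ≡ false) (sym q) (p-private j (c i) (c∈C i) (c≢c i≢j)))

corollary3p4 : ∀ {n : ℕ} (G : Graph n) (β ν ν₀ : ℕ) →
    IsCoverNumber G β → IsMatchingNumber G ν → IsInducedMatchingNumber G ν₀ →
    β ≡ ν →
    (m G ≤ 2 ^ ν) × (m G ≡ 2 ^ ν ⇔ (IsBipartite G × ν ≡ ν₀))
corollary3p4 G β ν ν₀ ((C , cover , ∣C∣≡β) , _) (matching , ν-max) (induced , ν₀-max) β≡ν =
  m≤2^ν , mk⇔ tight⇒ ⇒tight
  where
  ∣C∣≡ν : ∣ C ∣ ≡ ν
  ∣C∣≡ν = trans ∣C∣≡β β≡ν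
  m≤2^ν : m G ≤ 2 ^ ν
  m≤2^ν = subst (λ k → m G ≤ 2 ^ k) ∣C∣≡ν (m≤2^∣C∣ G cover)
  tight⇒ : m G ≡ 2 ^ ν → IsBipartite G × ν ≡ ν₀
  tight⇒ m≡2^ν = bipartite G cover complete ,
    ≤-antisym (ν₀-max ν (matching⇒inducedMatching G cover complete matching))
              (ν-max ν₀ (proj₁ induced , proj₁ (proj₂ induced)))
    where
    complete : TraceComplete G cover
    complete = m≡2^∣C∣⇒traceComplete G cover (trans m≡2^ν (cong (2 ^_) (sym ∣C∣≡ν)))
  ⇒tight : IsBipartite G × ν ≡ ν₀ → m G ≡ 2 ^ ν
  ⇒tight (_ , ν≡ν₀) = ≤-antisym m≤2^ν (subst (λ k → 2 ^ k ≤ m G) (sym ν≡ν₀) (2^k≤m G induced))
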